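{- For every $(\omega,\epsilon)\in D_n$, the induced subposet $\widetilde\Pi_{\omega,\epsilon}$ of $\Pi^D_n$ is isomorphic to the lattice of subsets of $[n]$.
   Context: $D_n$ is the set of signed permutations $(\omega,\epsilon)$ ($\omega\in S_n$, $\epsilon\in\{ -1,1\}^n$, $\omega(i)$ barred iff $\epsilon_i=-1$) with an even number of bars. For $(\omega,\epsilon)$, $\epsilon'$ is defined by $\epsilon'_1=-\epsilon_1$ and $\epsilon'_i=\epsilon_i$ for $i\ge2$. Signed partitions: partitions of $\{0,1,\dots,n\}$ in which nonminimal elements of blocks not containing $0$ (nonzero blocks) may be barred; the zero block has no bars. For a block $b$, $\bar b$ toggles all bars and $\widetilde b$ removes all bars. $\Pi^B_n$ is the poset of signed partitions with $\pi\le\tau$ iff for each block $b$ of $\pi$, either $b$ or $\bar b$ is contained (as a set of signed letters) in a nonzero block of $\tau$, or $\widetilde b$ is contained in the zero block of $\tau$. $\Pi^D_n$ is the subposet of $\Pi^B_n$ of signed partitions whose zero block does not have size 2. Splitting: to split a signed permutation $(\omega,\epsilon)$ at positions $i_1<\dots<i_k$ in $\{0,\dots,n-1\}$ (put $i_{k+1}=n$; for $k=0$ the result is the one-block partition) form the signed partition with zero block $\{0,\omega(1),\dots,\omega(i_1)\}$ and, for $j=1,\dots,k$, the nonzero block equal to whichever of $b_j=\{(\omega(i_j+1),\epsilon_{i_j+1}),\dots,(\omega(i_{j+1}),\epsilon_{i_{j+1}})\}$ or $\bar b_j$ has its minimal element unbarred ($(a,-1)=\bar a$, $(a,1)=a$).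 $\widetilde\Pi_{\omega,\epsilon}$ is the induced subposet of $\Pi^D_n$ of all signed partitions obtained by splitting $(\omega,\epsilon)$ or $(\omega,\epsilon')$ at all positions of a subset of $\{0,1,\dots,n-1\}$ whose smallest element is not $1$. -}

module Defs where

open import Data.Nat using (ℕ; zero; suc; _≤_; _<ᵇ_)
open import Data.Nat.Divisibility using (_∣_)
open import Data.Bool using (Bool; true; false; not; if_then_else_)
open import Data.Fin using (Fin; toℕ)
open import Data.Fin.Permutation using (Permutation′; _⟨$⟩ʳ_)
open import Data.Fin.Subset using (Subset; _∈_; _⊆_)
open import Data.List using (List; []; _∷_; map; allFin)
open import Data.Nat.ListAction using (sum)
open import Data.List.Membership.Propositional using () renaming (_∈_ to _∈ₗ_)
import Data.List.Relation.Binary.Subset.Propositional as LS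
open import Data.Product using (Σ; ∃; _×_; _,_; proj₁; proj₂)
open import Data.Sum using (_⊎_)
open import Relation.Binary.PropositionalEquality using (_≡_; _≢_)
import Data.Fin.Subset.Properties
import Relation.Nullary
import Data.Fin
open import Function.Bundles using (_⇔_)

-- Signed permutations
-- A signed permutation of [n] = {1,…,n}: ω is a permutation of Fin n,
-- the letter in (0-based) position j is  suc (toℕ (ω j)) ∈ [n],
-- and ε j = true means that this letter is barred (ε_j = -1).

BarVec : ℕ → Set
BarVec n = Fin n → Bool

numBars : ∀ {n} → BarVec n → ℕ
numBars {n} ε = sum (map (λ j → if ε j then 1 else 0) (allFin n))

InD : ∀ n → Permutation′ n → BarVec n → Set
InD n ω ε = 2 ∣ numBars ε

flipFirst : ∀ {n} → BarVec n → BarVec n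
flipFirst ε Fin.zero    = not (ε Fin.zero)
flipFirst ε (Fin.suc j) = ε (Fin.suc j)

-- a signed letter (a , true) is the barred letter ā, (a , false) is a
SLetter : Set
SLetter = ℕ × Bool

Block : Set
Block = List SLetter

barB : Block → Block
barB = map (λ x → proj₁ x , not (proj₂ x))

tildeB : Block → Block
tildeB = map (λ x → proj₁ x , false)

record SignedPartition : Set where
  constructor mkSP
  field
    zeroBlock    : Block
    nonzeroBlocks : List Block
open SignedPartition public

blocks : SignedPartition → List Block
blocks π = zeroBlock π ∷ nonzeroBlocks π

_≤B_ : SignedPartition → SignedPartition → Set
π ≤B τ = ∀ b → b ∈ₗ blocks π →
           (∃ λ c → c ∈ₗ nonzeroBlocks τ × (b LS.⊆ c ⊎ barB b LS.⊆ c))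
           ⊎ (tildeB b LS.⊆ zeroBlock τ)

_≈SP_ : SignedPartition → SignedPartition → Set
π ≈SP τ = (∀ b → b ∈ₗ blocks π → ∃ λ c → c ∈ₗ blocks τ × (b LS.⊆ c × c LS.⊆ b))
        × (∀ c → c ∈ₗ blocks τ → ∃ λ b → b ∈ₗ blocks π × (b LS.⊆ c × c LS.⊆ b))

-- barred-ness of the minimal element (by absolute value) of a block
-- (the empty block never occurs; it is given the value false)
minLetter : SLetter → Block → SLetter
minLetter m [] = m
minLetter m (x ∷ xs) = minLetter (if proj₁ x <ᵇ proj₁ m then x else m) xs

minIsBarred : Block → Bool
minIsBarred [] = false
minIsBarred (x ∷ xs) = proj₂ (minLetter x xs)

normalize : Block → Block
normalize b = if minIsBarred b then barB b else b

-- cut a word (each letter tagged with "a cut occurs right before it")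
-- into its initial segment and the list of following segments
segments : List (SLetter × Bool) → Block × List Block
segments [] = [] , []
segments ((x , c) ∷ xs) with segments xs
... | ys , bs = if c then ([] , (x ∷ ys) ∷ bs) else (x ∷ ys , bs)

-- the word of (ω , ε), tagged with cuts: a cut at position p ∈ {0,…,n-1}
-- (p ∈ S) separates ω(p) from ω(p+1), i.e. it occurs right before the
-- letter in 0-based position p
taggedWord : ∀ {n} → Permutation′ n → BarVec n → Subset n → List (SLetter × Bool)
taggedWord {n} ω ε S =
  map (λ j → (suc (toℕ (ω ⟨$⟩ʳ j)) , ε j) , isIn j) (allFin n)
  where
  isIn : Fin n → Bool
  isIn j with Data.Fin.Subset.Properties._∈?_ j S
  ... | Relation.Nullary.yes _ = true
  ... | Relation.Nullary.no _  = false

split : ∀ {n} → Permutation′ n → BarVec n → Subset n → SignedPartition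
split ω ε S with segments (taggedWord ω ε S)
... | z , bs = mkSP ((0 , false) ∷ tildeB z) (map normalize bs)

IsSmallest : ∀ {n} → Subset n → Fin n → Set
IsSmallest S p = p ∈ S × (∀ q → q ∈ S → toℕ p ≤ toℕ q)

AllowedCuts : ∀ {n} → Subset n → Set
AllowedCuts S = ∀ p → IsSmallest S p → toℕ p ≢ 1

-- an index for an element of Π̃_{ω,ε}: choose (ω,ε) (false) or (ω,ε')
-- (true), and an allowed set of cut positions
Index : ℕ → Set
Index n = Bool × Σ (Subset n) AllowedCuts

splitAt : ∀ {n} → Permutation′ n → BarVec n → Index n → SignedPartition
splitAt ω ε (false , S , _) = split ω ε S
splitAt ω ε (true  , S , _) = split ω (flipFirst ε) S

-- Π̃_{ω,ε} (elements: signed partitions of the form splitAt ω ε i, equality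
-- ≈SP, order ≤B) is isomorphic to the Boolean lattice (Subset n, ⊆):
-- there is a map Subset n → Π̃_{ω,ε} which is onto and is an order
-- embedding (hence also injective, since ⊆ is antisymmetric).
IsoToBoolean : ∀ n → Permutation′ n → BarVec n → Set
IsoToBoolean n ω ε =
  Σ (Subset n → Index n) λ f →
      (∀ A B → (A ⊆ B) ⇔ (splitAt ω ε (f A) ≤B splitAt ω ε (f B)))
    × (∀ i → ∃ λ A → splitAt ω ε (f A) ≈SP splitAt ω ε i)

-- Fix the signed word ω(1)…ω(n); its letters |ω(i)| are distinct and nonzero. Splitting it at a
-- set S of positions gives a signed partition, and fewer cuts give a larger partition: every
-- block of the finer splitting lies, up to bars, in a block of the coarser one. Conversely, ≤ in
-- Π^B_n makes the blocks with bars forgotten refine, and two adjacent letters share a block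
-- exactly when no cut separates them, so ≤ forces reverse inclusion of the cut sets. Flipping ε₁
-- is visible only when ω(1) opens a nonzero block of at least two letters (a cut at 0 but not at
-- 1), and there the two signs give incomparable partitions. Hence the positions 2, …, n−1
-- contribute a Boolean factor, and the four admissible configurations at positions 0 and 1
-- (both cut, a cut at 0 only with either sign, no cut; a cut at 1 alone is excluded) form the
-- Boolean lattice on two atoms.

module Submission where

open import Defs
open import Data.Nat using (ℕ; zero; suc; _≤_; z≤n; s≤s)
open import Data.Nat.Properties using (suc-injective)
open import Data.Bool using (Bool; true; false; not; _∧_; _∨_; _xor_; f≤t; b≤b)
  renaming (_≤_ to _≤ᵇ_)
open import Data.Bool.Properties using (not-involutive; not-¬; ¬-not; ≤-minimum; ≤-maximum)
open import Data.Fin using (Fin; zero; suc; toℕ)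
open import Data.Fin.Properties using (toℕ-injective)
open import Data.Fin.Permutation using (Permutation′; _⟨$⟩ʳ_; _⟨$⟩ˡ_; inverseˡ)
open import Data.Fin.Subset using (Subset; _⊆_; inside; outside; ∁) renaming (_∈_ to _∈ₛ_)
open import Data.Fin.Subset.Properties
  using (_∈?_; drop-∷-⊆; out⊆; s⊆s; p⊆q⇒∁p⊇∁q; ∁p⊆∁q⇒p⊇q)
open import Data.List using (List; []; _∷_; map; allFin)
import Data.List as List
import Data.List.Properties as List
open import Data.List.Membership.Propositional using (_∈_; _∉_; find; lose)
open import Data.List.Membership.Propositional.Properties using (∈-map⁺; ∈-map⁻)
open import Data.List.Relation.Binary.Subset.Propositional using () renaming (_⊆_ to _⊆ₗ_)
open import Data.List.Relation.Binary.Subset.Propositional.Properties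
  using (⊆-trans; ⊆-reflexive; xs⊆x∷xs; ∷⁺ʳ)
  renaming (map⁺ to ⊆-map⁺)
open import Data.List.Relation.Unary.All as All using (All; []; _∷_)
open import Data.List.Relation.Unary.All.Properties using (All¬⇒¬Any)
  renaming (map⁺ to All-map⁺; tabulate⁺ to All-tabulate⁺)
open import Data.List.Relation.Unary.Any as Any using (Any; here; there)
open import Data.List.Relation.Unary.Any.Properties using () renaming (map⁺ to Any-map⁺)
open import Data.List.Relation.Unary.Unique.Propositional using (Unique)
open import Data.List.Relation.Unary.Unique.Propositional.Properties using ()
  renaming (tabulate⁺ to Unique-tabulate⁺)
open import Data.List.Relation.Unary.AllPairs using (_∷_)
open import Data.Vec using (Vec; []; _∷_; toList)
import Data.Vec as Vec
import Data.Vec.Properties as Vec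
open import Data.Vec.Base using () renaming (here to vhere; there to vthere)
open import Data.Product using (Σ; ∃; _×_; _,_; proj₁; proj₂; map₁)
import Data.Product as Product
open import Data.Sum using (_⊎_; inj₁; inj₂)
open import Data.Empty using (⊥; ⊥-elim)
open import Function using (_∘_; id)
open import Function.Bundles using (_⇔_; mk⇔)
import Function.Properties.Equivalence as ⇔
open import Relation.Nullary using (¬_; Dec; yes; no; contradiction)
open import Relation.Binary.PropositionalEquality

∧-mono-≤ : ∀ {a b c d} → a ≤ᵇ b → c ≤ᵇ d → a ∧ c ≤ᵇ b ∧ d
∧-mono-≤ f≤t           _   = ≤-minimum _
∧-mono-≤ (b≤b {false}) _   = b≤b
∧-mono-≤ (b≤b {true})  c≤d = c≤d

∨-mono-≤ : ∀ {a b c d} → a ≤ᵇ b → c ≤ᵇ d → a ∨ c ≤ᵇ b ∨ d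
∨-mono-≤ f≤t           _   = ≤-maximum _
∨-mono-≤ (b≤b {false}) c≤d = c≤d
∨-mono-≤ (b≤b {true})  _   = b≤b

not-antitone-≤ : ∀ {a b} → a ≤ᵇ b → not b ≤ᵇ not a
not-antitone-≤ f≤t = f≤t
not-antitone-≤ b≤b = b≤b

∷⊆∷⁺ : ∀ {n a b} {A B : Subset n} → a ≤ᵇ b → A ⊆ B → a ∷ A ⊆ b ∷ B
∷⊆∷⁺ f≤t           = out⊆
∷⊆∷⁺ (b≤b {false}) = out⊆
∷⊆∷⁺ (b≤b {true})  = s⊆s

∷⊆∷⁻ : ∀ {n a b} {A B : Subset n} → a ∷ A ⊆ b ∷ B → a ≤ᵇ b
∷⊆∷⁻ {a = false} {b} _ = ≤-minimum b
∷⊆∷⁻ {a = true} aA⊆bB with aA⊆bB vhere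
... | vhere = b≤b

∁-involutive : ∀ {n} (S : Subset n) → ∁ (∁ S) ≡ S
∁-involutive S =
  trans (sym (Vec.map-∘ not not S)) (trans (Vec.map-cong not-involutive S) (Vec.map-id S))

-- Cutting tagged lists into blocks

module _ {A : Set} where

  tagged : ∀ {n} → Vec A n → Subset n → List (A × Bool)
  tagged []       []       = []
  tagged (x ∷ xs) (s ∷ S) = (x , s) ∷ tagged xs S

  cutBefore : A → Bool → List A × List (List A) → List A × List (List A)
  cutBefore x true  (z , bs) = [] , (x ∷ z) ∷ bs
  cutBefore x false (z , bs) = x ∷ z , bs

  cutAll : List (A × Bool) → List A × List (List A)
  cutAll []            = [] , []
  cutAll ((x , c) ∷ L) = cutBefore x c (cutAll L)

  cutBlocks : List (A × Bool) → List (List A)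
  cutBlocks L = proj₁ (cutAll L) ∷ proj₂ (cutAll L)

  keys-tagged : ∀ {n} (xs : Vec A n) S → map proj₁ (tagged xs S) ≡ toList xs
  keys-tagged []       []      = refl
  keys-tagged (x ∷ xs) (s ∷ S) = cong (x ∷_) (keys-tagged xs S)

  _⊑_ : List (List A) → List (List A) → Set
  bs ⊑ cs = All (λ b → Any (b ⊆ₗ_) cs) bs

  Together : List (List A) → A → A → Set
  Together bs u v = Any (λ b → u ∈ b × v ∈ b) bs

  together-⊑ : ∀ {bs cs u v} → bs ⊑ cs → Together bs u v → Together cs u v
  together-⊑ (b⊆ ∷ _) (here (u∈ , v∈)) = Any.map (λ b⊆c → b⊆c u∈ , b⊆c v∈) b⊆
  together-⊑ (_ ∷ bs⊑) (there t)       = together-⊑ bs⊑ t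

  Refines : List A × List (List A) → List A × List (List A) → Set
  Refines (z , bs) (z′ , bs′) = z ⊆ₗ z′ × bs ⊑ (z′ ∷ bs′)

  ⊆-head-∷ : ∀ {x : A} {b z : List A} {bs} → Any (b ⊆ₗ_) (z ∷ bs) → Any (b ⊆ₗ_) ((x ∷ z) ∷ bs)
  ⊆-head-∷ {x} (here b⊆z) = here (⊆-trans b⊆z (xs⊆x∷xs _ x))
  ⊆-head-∷     (there p)  = there p

  cutBefore-refines : ∀ {x s t p q} → t ≤ᵇ s → Refines p q →
                      Refines (cutBefore x s p) (cutBefore x t q)
  cutBefore-refines {x} (b≤b {false}) (z⊆ , bs⊑) = ∷⁺ʳ x z⊆ , All.map (⊆-head-∷ {x}) bs⊑
  cutBefore-refines {x} f≤t (z⊆ , bs⊑) = (λ ()) , here (∷⁺ʳ x z⊆) ∷ All.map (⊆-head-∷ {x}) bs⊑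
  cutBefore-refines {x} (b≤b {true}) (z⊆ , bs⊑) =
    (λ ()) , there (here (∷⁺ʳ x z⊆)) ∷ All.map (there ∘ ⊆-head-∷ {x}) bs⊑

  cutAll-refines : ∀ {n} (xs : Vec A n) {S T : Subset n} → T ⊆ S →
                   Refines (cutAll (tagged xs S)) (cutAll (tagged xs T))
  cutAll-refines []       {[]}    {[]}    _   = (λ ()) , []
  cutAll-refines (x ∷ xs) {s ∷ S} {t ∷ T} T⊆S =
    cutBefore-refines (∷⊆∷⁻ T⊆S) (cutAll-refines xs (drop-∷-⊆ T⊆S))

  data Adjacent : List (A × Bool) → A → A → Bool → Set where
    now   : ∀ {u v c t L} → Adjacent ((u , c) ∷ (v , t) ∷ L) u v t
    later : ∀ {x u v t L} → Adjacent L u v t → Adjacent (x ∷ L) u v t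

  adjacent-∈ : ∀ {L u v t} → Adjacent L u v t → u ∈ map proj₁ L × v ∈ map proj₁ L
  adjacent-∈ now       = here refl , there (here refl)
  adjacent-∈ (later a) = Product.map there there (adjacent-∈ a)

  ∈-cutBlocks : ∀ {L u} → Any (u ∈_) (cutBlocks L) → u ∈ map proj₁ L
  ∈-cutBlocks {[]} (here ())
  ∈-cutBlocks {[]} (there ())
  ∈-cutBlocks {(x , true) ∷ L} (here ())
  ∈-cutBlocks {(x , true) ∷ L} (there (here (here u≡x)))  = here u≡x
  ∈-cutBlocks {(x , true) ∷ L} (there (here (there u∈))) = there (∈-cutBlocks {L} (here u∈))
  ∈-cutBlocks {(x , true) ∷ L} (there (there p))         = there (∈-cutBlocks {L} (there p))
  ∈-cutBlocks {(x , false) ∷ L} (here (here u≡x))        = here u≡x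
  ∈-cutBlocks {(x , false) ∷ L} (here (there u∈))       = there (∈-cutBlocks {L} (here u∈))
  ∈-cutBlocks {(x , false) ∷ L} (there p)               = there (∈-cutBlocks {L} (there p))

  together-∷ : ∀ {x} c {L u v} → Together (cutBlocks L) u v → Together (cutBlocks ((x , c) ∷ L)) u v
  together-∷ true  (here (u∈ , v∈)) = there (here (there u∈ , there v∈))
  together-∷ true  (there t)         = there (there t)
  together-∷ false (here (u∈ , v∈)) = here (there u∈ , there v∈)
  together-∷ false (there t)         = there t

  together-∷⁻ : ∀ {x} c {L u v} → u ≢ x → v ≢ x →
                Together (cutBlocks ((x , c) ∷ L)) u v → Together (cutBlocks L) u v
  together-∷⁻ true  u≢x v≢x (here (() , _))
  together-∷⁻ true  u≢x v≢x (there (here (u∈ , v∈))) = here (Any.tail u≢x u∈ , Any.tail v≢x v∈)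
  together-∷⁻ true  u≢x v≢x (there (there t))        = there t
  together-∷⁻ false u≢x v≢x (here (u∈ , v∈))         = here (Any.tail u≢x u∈ , Any.tail v≢x v∈)
  together-∷⁻ false u≢x v≢x (there t)                = there t

  ∈-later-block : ∀ {u v} L → Any (λ b → u ∈ b × v ∈ b) (proj₂ (cutAll L)) → u ∈ map proj₁ L
  ∈-later-block L t = ∈-cutBlocks {L} (there (Any.map proj₁ t))

  together-head : ∀ {u c v} L → u ∉ map proj₁ L →
                  Together (cutBlocks ((u , c) ∷ L)) u v → v ∈ u ∷ proj₁ (cutAll L)
  together-head {c = true}  L u∉ (here (() , _))
  together-head {c = true}  L u∉ (there (here (_ , v∈))) = v∈
  together-head {c = true}  L u∉ (there (there t))       = contradiction (∈-later-block L t) u∉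
  together-head {c = false} L u∉ (here (_ , v∈))         = v∈
  together-head {c = false} L u∉ (there t)               = contradiction (∈-later-block L t) u∉

  uncut⇒together : ∀ {L u v} → Adjacent L u v false → Together (cutBlocks L) u v
  uncut⇒together {(_ , true) ∷ _}  now = there (here (here refl , there (here refl)))
  uncut⇒together {(_ , false) ∷ _} now = here (here refl , there (here refl))
  uncut⇒together {(_ , c) ∷ L} (later a) = together-∷ c {L} (uncut⇒together a)

  cut⇒apart : ∀ {L u v} → Unique (map proj₁ L) → Adjacent L u v true → ¬ Together (cutBlocks L) u v
  cut⇒apart {(u , c) ∷ (v , true) ∷ L} ((u≢v ∷ u∉L) ∷ _) now t
    with together-head {c = c} ((v , true) ∷ L) (All¬⇒¬Any (u≢v ∷ u∉L)) t
  ... | here v≡u = u≢v (sym v≡u)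
  ... | there ()
  cut⇒apart {(x , c) ∷ L} (x∉L ∷ U) (later a) t =
    cut⇒apart U a (together-∷⁻ c {L} (≢x (proj₁ (adjacent-∈ a))) (≢x (proj₂ (adjacent-∈ a))) t)
    where
    ≢x : ∀ {y} → y ∈ map proj₁ L → y ≢ x
    ≢x y∈ y≡x = All.lookup x∉L y∈ (sym y≡x)

  no-new-cut⇒⊆ : ∀ {n} x (xs : Vec A n) c d (S T : Subset n) →
    (∀ {u v} → Adjacent (tagged (x ∷ xs) (c ∷ S)) u v false →
               Adjacent (tagged (x ∷ xs) (d ∷ T)) u v true → ⊥) →
    T ⊆ S
  no-new-cut⇒⊆ x []       c d []          []      _ ()
  no-new-cut⇒⊆ x (y ∷ xs) c d (true ∷ S)  (t ∷ T) keep =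
    ∷⊆∷⁺ (≤-maximum t) (no-new-cut⇒⊆ y xs true t S T (λ a → keep (later a) ∘ later))
  no-new-cut⇒⊆ x (y ∷ xs) c d (false ∷ S) (false ∷ T) keep =
    ∷⊆∷⁺ b≤b (no-new-cut⇒⊆ y xs false false S T (λ a → keep (later a) ∘ later))
  no-new-cut⇒⊆ x (y ∷ xs) c d (false ∷ S) (true ∷ T) keep = ⊥-elim (keep now now)

  coarser⇒fewer-cuts : ∀ {n x} {xs : Vec A n} {c d S T} → Unique (toList (x ∷ xs)) →
    cutBlocks (tagged (x ∷ xs) (c ∷ S)) ⊑ cutBlocks (tagged (x ∷ xs) (d ∷ T)) → T ⊆ S
  coarser⇒fewer-cuts {x = x} {xs} {c} {d} {S} {T} U finer =
    no-new-cut⇒⊆ x xs c d S T λ uncut cut →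
      cut⇒apart U′ cut (together-⊑ finer (uncut⇒together uncut))
    where
    U′ : Unique (map proj₁ (tagged (x ∷ xs) (d ∷ T)))
    U′ = subst Unique (sym (keys-tagged (x ∷ xs) (d ∷ T))) U

cutAll-map : ∀ {A B : Set} (f : A → B) L →
  cutAll (map (map₁ f) L) ≡ Product.map (map f) (map (map f)) (cutAll L)
cutAll-map f []                = refl
cutAll-map f ((x , true) ∷ L)  rewrite cutAll-map f L = refl
cutAll-map f ((x , false) ∷ L) rewrite cutAll-map f L = refl

tagged-map : ∀ {A B : Set} {n} (f : A → B) (xs : Vec A n) S →
  map (map₁ f) (tagged xs S) ≡ tagged (Vec.map f xs) S
tagged-map f []       []      = refl
tagged-map f (x ∷ xs) (s ∷ S) = cong ((f x , s) ∷_) (tagged-map f xs S)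

-- Signed blocks and split partitions

keys : ∀ {n} → Vec SLetter n → List ℕ
keys W = toList (Vec.map proj₁ W)

_⊆±_ : Block → Block → Set
b ⊆± c = b ⊆ₗ c ⊎ barB b ⊆ₗ c

barB-involutive : ∀ b → barB (barB b) ≡ b
barB-involutive []            = refl
barB-involutive ((a , e) ∷ b) = cong₂ _∷_ (cong (a ,_) (not-involutive e)) (barB-involutive b)

keys-barB : ∀ b → map proj₁ (barB b) ≡ map proj₁ b
keys-barB b = sym (List.map-∘ b)

keys-tildeB : ∀ b → map proj₁ (tildeB b) ≡ map proj₁ b
keys-tildeB b = sym (List.map-∘ b)

tildeB-barB : ∀ b → tildeB (barB b) ≡ tildeB b
tildeB-barB b = sym (List.map-∘ b)

tildeB-idem : ∀ b → tildeB (tildeB b) ≡ tildeB b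
tildeB-idem b = sym (List.map-∘ b)

keys-normalize : ∀ b → map proj₁ (normalize b) ≡ map proj₁ b
keys-normalize b with minIsBarred b
... | true  = keys-barB b
... | false = refl

tildeB-normalize : ∀ b → tildeB (normalize b) ≡ tildeB b
tildeB-normalize b with minIsBarred b
... | true  = tildeB-barB b
... | false = refl

normalize-singleton : ∀ x → normalize (x ∷ []) ≡ (proj₁ x , false) ∷ []
normalize-singleton (a , true)  = refl
normalize-singleton (a , false) = refl

⊆±-barˡ : ∀ {b c} → b ⊆± c → barB b ⊆± c
⊆±-barˡ (inj₁ b⊆c) = inj₂ (subst (_⊆ₗ _) (sym (barB-involutive _)) b⊆c)
⊆±-barˡ (inj₂ b̄⊆c) = inj₁ b̄⊆c

⊆±-barʳ : ∀ {b c} → b ⊆± c → b ⊆± barB c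
⊆±-barʳ (inj₁ b⊆c) = inj₂ (⊆-map⁺ _ b⊆c)
⊆±-barʳ {b} (inj₂ b̄⊆c) = inj₁ (subst (_⊆ₗ _) (barB-involutive b) (⊆-map⁺ _ b̄⊆c))

⊆±-unbarˡ : ∀ {b c} → barB b ⊆± c → b ⊆± c
⊆±-unbarˡ {b} = subst (_⊆± _) (barB-involutive b) ∘ ⊆±-barˡ

⊆±-unbarʳ : ∀ {b c} → b ⊆± barB c → b ⊆± c
⊆±-unbarʳ {c = c} = subst (_ ⊆±_) (barB-involutive c) ∘ ⊆±-barʳ

normalize-⊆± : ∀ {b c} → b ⊆± c → normalize b ⊆± normalize c
normalize-⊆± {b} {c} b⊆±c with minIsBarred b | minIsBarred c
... | false | false = b⊆±c
... | false | true  = ⊆±-barʳ b⊆±c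
... | true  | false = ⊆±-barˡ b⊆±c
... | true  | true  = ⊆±-barˡ (⊆±-barʳ b⊆±c)

normalize-⊆±⁻ : ∀ {b c} → normalize b ⊆± normalize c → b ⊆± c
normalize-⊆±⁻ {b} {c} b⊆±c with minIsBarred b | minIsBarred c
... | false | false = b⊆±c
... | false | true  = ⊆±-unbarʳ b⊆±c
... | true  | false = ⊆±-unbarˡ b⊆±c
... | true  | true  = ⊆±-unbarˡ (⊆±-unbarʳ b⊆±c)

⊆±⇒keys-⊆ : ∀ {b c} → b ⊆± c → map proj₁ b ⊆ₗ map proj₁ c
⊆±⇒keys-⊆     (inj₁ b⊆c) = ⊆-map⁺ proj₁ b⊆c
⊆±⇒keys-⊆ {b} (inj₂ b̄⊆c) = subst (_⊆ₗ _) (keys-barB b) (⊆-map⁺ proj₁ b̄⊆c)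

fromSegments : Block × List Block → SignedPartition
fromSegments (z , bs) = mkSP ((0 , false) ∷ tildeB z) (map normalize bs)

splitWord : ∀ {n} → Vec SLetter n → Subset n → SignedPartition
splitWord W S = fromSegments (cutAll (tagged W S))

absBlocks : SignedPartition → List (List ℕ)
absBlocks π = map (map proj₁) (blocks π)

≤B⇒keys-block : ∀ {π τ} → π ≤B τ → ∀ {b} → b ∈ blocks π →
                Any (λ c → map proj₁ b ⊆ₗ map proj₁ c) (blocks τ)
≤B⇒keys-block π≤τ {b} b∈ with π≤τ b b∈
... | inj₁ (c , c∈ , b⊆±c) = lose (there c∈) (⊆±⇒keys-⊆ b⊆±c)
... | inj₂ b̃⊆z            = lose (here refl) (subst (_⊆ₗ _) (keys-tildeB b) (⊆-map⁺ proj₁ b̃⊆z))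

≤B⇒⊑ : ∀ {π τ} → π ≤B τ → absBlocks π ⊑ absBlocks τ
≤B⇒⊑ π≤τ = All-map⁺ (All.tabulate (λ b∈ → Any-map⁺ (≤B⇒keys-block π≤τ b∈)))

absBlocks-splitWord : ∀ {n} (W : Vec SLetter n) S →
  absBlocks (splitWord W S) ≡ cutBlocks (tagged (0 ∷ Vec.map proj₁ W) (false ∷ S))
absBlocks-splitWord W S = begin
  (0 ∷ map proj₁ (tildeB z)) ∷ map (map proj₁) (map normalize bs)
    ≡⟨ cong₂ (λ z′ bs′ → (0 ∷ z′) ∷ bs′) (keys-tildeB z)
             (trans (sym (List.map-∘ bs)) (List.map-cong keys-normalize bs)) ⟩
  (0 ∷ map proj₁ z) ∷ map (map proj₁) bs
    ≡⟨ cong (λ p → (0 ∷ proj₁ p) ∷ proj₂ p) (sym (cutAll-map proj₁ (tagged W S))) ⟩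
  cutBlocks ((0 , false) ∷ map (map₁ proj₁) (tagged W S))
    ≡⟨ cong (λ L → cutBlocks ((0 , false) ∷ L)) (tagged-map proj₁ W S) ⟩
  cutBlocks (tagged (0 ∷ Vec.map proj₁ W) (false ∷ S)) ∎
  where
  open ≡-Reasoning
  z : Block
  z = proj₁ (cutAll (tagged W S))
  bs : List Block
  bs = proj₂ (cutAll (tagged W S))

fromSegments-mono : ∀ {p q} → Refines p q → fromSegments p ≤B fromSegments q
fromSegments-mono {z , _} (z⊆z′ , _) _ (here refl) =
  inj₂ (∷⁺ʳ _ (⊆-trans (⊆-reflexive (tildeB-idem z)) (⊆-map⁺ _ z⊆z′)))
fromSegments-mono {_ , bs} (_ , bs⊑) _ (there b∈) with ∈-map⁻ normalize b∈
... | b , b∈bs , refl with All.lookup bs⊑ b∈bs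
...   | here b⊆z′ =
  inj₂ (⊆-trans (⊆-reflexive (tildeB-normalize b)) (⊆-trans (⊆-map⁺ _ b⊆z′) (xs⊆x∷xs _ _)))
...   | there b⊆some with find b⊆some
...     | c , c∈ , b⊆c = inj₁ (normalize c , ∈-map⁺ normalize c∈ , normalize-⊆± (inj₁ b⊆c))

splitWord-mono : ∀ {n} (W : Vec SLetter n) {S T} → T ⊆ S → splitWord W S ≤B splitWord W T
splitWord-mono W T⊆S = fromSegments-mono (cutAll-refines W T⊆S)

keys-cutBlocks : ∀ {n} (W : Vec SLetter n) T {b} → b ∈ cutBlocks (tagged W T) →
                 map proj₁ b ⊆ₗ keys W
keys-cutBlocks W T b∈ k∈ with ∈-map⁻ proj₁ k∈
... | a , a∈b , refl = subst (_ ∈_) (sym (Vec.toList-map proj₁ W))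
  (∈-map⁺ proj₁ (subst (_ ∈_) (keys-tagged W T) (∈-cutBlocks (lose b∈ a∈b))))

-- The sign of the first letter

signLetter : Bool → SLetter → SLetter
signLetter s (a , e) = a , s xor e

signed : ∀ {n} → Bool → Vec SLetter n → Vec SLetter n
signed s []      = []
signed s (x ∷ W) = signLetter s x ∷ W

signLetter-injective : ∀ {s t} x → signLetter s x ≡ signLetter t x → s ≡ t
signLetter-injective {false} {false} _       _  = refl
signLetter-injective {true}  {true}  _       _  = refl
signLetter-injective {false} {true}  (a , e) eq = contradiction (cong proj₂ eq) (not-¬ refl)
signLetter-injective {true}  {false} (a , e) eq = contradiction (sym (cong proj₂ eq)) (not-¬ refl)

keys-signed : ∀ {n} s (W : Vec SLetter n) → Vec.map proj₁ (signed s W) ≡ Vec.map proj₁ W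
keys-signed s []      = refl
keys-signed s (x ∷ W) = refl

SignedCuts : ℕ → Set
SignedCuts n = Bool × Subset n

splitSigned : ∀ {n} → Vec SLetter n → SignedCuts n → SignedPartition
splitSigned W (s , S) = splitWord (signed s W) S

absBlocks-splitSigned : ∀ {n} (W : Vec SLetter n) s S →
  absBlocks (splitSigned W (s , S)) ≡ cutBlocks (tagged (0 ∷ Vec.map proj₁ W) (false ∷ S))
absBlocks-splitSigned W s S = trans (absBlocks-splitWord (signed s W) S)
  (cong (λ ks → cutBlocks (tagged (0 ∷ ks) (false ∷ S))) (keys-signed s W))

splitSigned-antitone : ∀ {n} {W : Vec SLetter n} {s t S T} → Unique (0 ∷ keys W) →
  splitSigned W (s , S) ≤B splitSigned W (t , T) → T ⊆ S
splitSigned-antitone {W = W} {s} {t} {S} {T} U π≤τ =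
  coarser⇒fewer-cuts {x = 0} {xs = Vec.map proj₁ W} {c = false} {d = false} {S = S} {T = T} U
  (subst₂ _⊑_ (absBlocks-splitSigned W s S) (absBlocks-splitSigned W t T)
          (≤B⇒⊑ {splitSigned W (s , S)} {splitSigned W (t , T)} π≤τ))

-- The first letter opens a nonzero block of at least two letters, the only place its bar is seen.
data SignSensitive : ∀ {n} → Subset n → Set where
  long-first-block : ∀ {n} {S : Subset n} → SignSensitive (inside ∷ outside ∷ S)

signSensitive? : ∀ {n} (S : Subset n) → Dec (SignSensitive S)
signSensitive? []                    = no λ ()
signSensitive? (outside ∷ S)         = no λ ()
signSensitive? (inside ∷ [])         = no λ ()
signSensitive? (inside ∷ inside ∷ S)  = no λ ()
signSensitive? (inside ∷ outside ∷ S) = yes long-first-block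

normalize-signLetter : ∀ s t x → normalize (signLetter s x ∷ []) ≡ normalize (signLetter t x ∷ [])
normalize-signLetter s t x =
  trans (normalize-singleton (signLetter s x)) (sym (normalize-singleton (signLetter t x)))

fromSegments-singleton : ∀ {x y bs} → normalize (x ∷ []) ≡ normalize (y ∷ []) →
  fromSegments ([] , (x ∷ []) ∷ bs) ≡ fromSegments ([] , (y ∷ []) ∷ bs)
fromSegments-singleton {bs = bs} eq = cong (λ b → mkSP ((0 , false) ∷ []) (b ∷ map normalize bs)) eq

sign-irrelevant : ∀ {n} {W : Vec SLetter n} {s t S} → ¬ SignSensitive S →
                  splitSigned W (s , S) ≡ splitSigned W (t , S)
sign-irrelevant {W = []}        {S = []}                   _ = refl
sign-irrelevant {W = _ ∷ _}     {S = outside ∷ _}          _ = refl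
sign-irrelevant {W = x ∷ []}    {s} {t} {inside ∷ []}      _ =
  fromSegments-singleton (normalize-signLetter s t x)
sign-irrelevant {W = x ∷ y ∷ W} {s} {t} {inside ∷ inside ∷ S} _ =
  fromSegments-singleton {bs = proj₂ (cutAll (tagged (y ∷ W) (inside ∷ S)))}
                         (normalize-signLetter s t x)
sign-irrelevant {S = inside ∷ outside ∷ _} insensitive = contradiction long-first-block insensitive

splitSigned-sign-cong : ∀ {n} {W : Vec SLetter n} {s t S} → (SignSensitive S → s ≡ t) →
                        splitSigned W (s , S) ≡ splitSigned W (t , S)
splitSigned-sign-cong {W = W} {S = S} agree with signSensitive? S
... | yes σ = cong (λ s → splitSigned W (s , S)) (agree σ)
... | no ¬σ = sign-irrelevant {W = W} ¬σ

sign-visible : ∀ {n} {W : Vec SLetter n} {s t S T} → SignSensitive S → SignSensitive T →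
  Unique (0 ∷ keys W) → splitSigned W (s , S) ≤B splitSigned W (t , T) → s ≡ t
sign-visible {W = x ∷ y ∷ W} {s} {t} {inside ∷ outside ∷ S} {inside ∷ outside ∷ T}
             long-first-block long-first-block ((0≢x ∷ _) ∷ (x≢y ∷ x∉W) ∷ y∉W ∷ _) π≤τ =
  from-first-block (π≤τ _ (there (here refl)))
  where
  z z′ : Block
  z  = proj₁ (cutAll (tagged W S))
  z′ = proj₁ (cutAll (tagged W T))

  ∉z′ : ∀ {a} → proj₁ a ∉ keys W → a ∉ z′
  ∉z′ a∉ a∈ = a∉ (keys-cutBlocks W T (here refl) (∈-map⁺ proj₁ a∈))

  signs-agree : (signLetter s x ∷ y ∷ z) ⊆± (signLetter t x ∷ y ∷ z′) → s ≡ t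
  signs-agree (inj₁ b⊆c) with b⊆c (here refl)
  ... | here sx≡tx         = signLetter-injective x sx≡tx
  ... | there (here sx≡y)  = contradiction (cong proj₁ sx≡y) x≢y
  ... | there (there sx∈)  = contradiction sx∈ (∉z′ (All¬⇒¬Any x∉W))
  signs-agree (inj₂ b̄⊆c) with b̄⊆c (there (here refl))
  ... | here ȳ≡tx          = contradiction (sym (cong proj₁ ȳ≡tx)) x≢y
  ... | there (here ȳ≡y)   = contradiction (sym (cong proj₂ ȳ≡y)) (not-¬ refl)
  ... | there (there ȳ∈)   = contradiction ȳ∈ (∉z′ (All¬⇒¬Any y∉W))

  from-first-block :
    (∃ λ c → c ∈ nonzeroBlocks (splitSigned (x ∷ y ∷ W) (t , inside ∷ outside ∷ T)) ×
             normalize (signLetter s x ∷ y ∷ z) ⊆± c)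
    ⊎ (tildeB (normalize (signLetter s x ∷ y ∷ z)) ⊆ₗ (0 , false) ∷ []) →
    s ≡ t
  from-first-block (inj₂ b̃⊆zero)
    with b̃⊆zero (subst ((proj₁ x , false) ∈_) (sym (tildeB-normalize (signLetter s x ∷ y ∷ z)))
                       (here refl))
  ... | here x≡0 = contradiction (sym (cong proj₁ x≡0)) 0≢x
  ... | there ()
  from-first-block (inj₁ (_ , here refl , b⊆±c)) = signs-agree (normalize-⊆±⁻ b⊆±c)
  from-first-block (inj₁ (_ , there c∈ , b⊆±c)) with ∈-map⁻ normalize c∈
  ... | c , c∈bs , refl = contradiction
    (keys-cutBlocks W T (there c∈bs) (subst (proj₁ x ∈_) (keys-normalize c) (⊆±⇒keys-⊆ b⊆±c x∈b)))
    (All¬⇒¬Any x∉W)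
    where
    x∈b : proj₁ x ∈ map proj₁ (normalize (signLetter s x ∷ y ∷ z))
    x∈b = subst (proj₁ x ∈_) (sym (keys-normalize (signLetter s x ∷ y ∷ z))) (here refl)

_≼_ : ∀ {n} → SignedCuts n → SignedCuts n → Set
(s , S) ≼ (t , T) = T ⊆ S × (SignSensitive S → SignSensitive T → s ≡ t)

splitSigned-≤B⇔≼ : ∀ {n} {W : Vec SLetter n} → Unique (0 ∷ keys W) →
  ∀ σ τ → (splitSigned W σ ≤B splitSigned W τ) ⇔ (σ ≼ τ)
splitSigned-≤B⇔≼ {W = W} U (s , S) (t , T) = mk⇔ ≤B⇒≼ ≼⇒≤B
  where
  ≤B⇒≼ : splitSigned W (s , S) ≤B splitSigned W (t , T) → (s , S) ≼ (t , T)
  ≤B⇒≼ π≤τ = splitSigned-antitone U π≤τ , λ σS σT → sign-visible σS σT U π≤τ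

  ≼⇒≤B : (s , S) ≼ (t , T) → splitSigned W (s , S) ≤B splitSigned W (t , T)
  ≼⇒≤B (T⊆S , agree) with signSensitive? T
  ... | yes σT = subst (_≤B splitSigned W (t , T))
                       (splitSigned-sign-cong {W = W} (λ σS → sym (agree σS σT)))
                       (splitWord-mono (signed t W) T⊆S)
  ... | no ¬σT = subst (splitSigned W (s , S) ≤B_)
                       (splitSigned-sign-cong {W = W} (λ σT → contradiction σT ¬σT))
                       (splitWord-mono (signed s W) T⊆S)

-- Encoding subsets of [n] as signed cut sets

-- Positions ≥ 2 are cut exactly outside A. At positions 0 and 1, A ∩ {0,1} = ∅, {0}, {1}, {0,1}
-- give: cuts at 0 and 1; a cut at 0 only; a cut at 0 only with the first sign flipped; no cut.
encode : ∀ {n} → Subset n → SignedCuts n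
encode []            = false , []
encode (a ∷ [])      = false , ∁ (a ∷ [])
encode (a₀ ∷ a₁ ∷ A) = not a₀ ∧ a₁ , not (a₀ ∧ a₁) ∷ not (a₀ ∨ a₁) ∷ ∁ A

encode-signs-agree : ∀ {n a₀ a₁ b₀ b₁} {A B : Subset n} → a₀ ≤ᵇ b₀ → a₁ ≤ᵇ b₁ →
  SignSensitive (proj₂ (encode (a₀ ∷ a₁ ∷ A))) → SignSensitive (proj₂ (encode (b₀ ∷ b₁ ∷ B))) →
  proj₁ (encode (a₀ ∷ a₁ ∷ A)) ≡ proj₁ (encode (b₀ ∷ b₁ ∷ B))
encode-signs-agree               b≤b b≤b _  _  = refl
encode-signs-agree {a₁ = false}  f≤t b≤b () _
encode-signs-agree {a₁ = true}   f≤t b≤b _  ()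
encode-signs-agree {a₀ = false}  b≤b f≤t () _
encode-signs-agree {a₀ = true}   b≤b f≤t _  ()
encode-signs-agree               f≤t f≤t () _

encode-heads-≤ : ∀ {n} a₀ a₁ b₀ b₁ {A B : Subset n} →
  not (b₀ ∧ b₁) ≤ᵇ not (a₀ ∧ a₁) → not (b₀ ∨ b₁) ≤ᵇ not (a₀ ∨ a₁) →
  (SignSensitive (proj₂ (encode (a₀ ∷ a₁ ∷ A))) → SignSensitive (proj₂ (encode (b₀ ∷ b₁ ∷ B))) →
   proj₁ (encode (a₀ ∷ a₁ ∷ A)) ≡ proj₁ (encode (b₀ ∷ b₁ ∷ B))) →
  a₀ ≤ᵇ b₀ × a₁ ≤ᵇ b₁
encode-heads-≤ false false b₀    b₁    _  _  _     = ≤-minimum b₀ , ≤-minimum b₁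
encode-heads-≤ true  true  true  true  _  _  _     = b≤b , b≤b
encode-heads-≤ true  true  false _     () _  _
encode-heads-≤ true  true  true  false () _  _
encode-heads-≤ true  false true  b₁    _  _  _     = b≤b , ≤-minimum b₁
encode-heads-≤ true  false false false _  () _
encode-heads-≤ true  false false true  _  _  agree =
  contradiction (agree long-first-block long-first-block) λ ()
encode-heads-≤ false true  b₀    true  _  _  _     = ≤-minimum b₀ , b≤b
encode-heads-≤ false true  false false _  () _
encode-heads-≤ false true  true  false _  _  agree =
  contradiction (agree long-first-block long-first-block) λ ()

encode-⊆⇔≼ : ∀ {n} (A B : Subset n) → (A ⊆ B) ⇔ (encode A ≼ encode B)
encode-⊆⇔≼ []       []       = mk⇔ (λ _ → (λ ()) , λ ()) (λ _ ())
encode-⊆⇔≼ (a ∷ []) (b ∷ []) = mk⇔ to from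
  where
  to : a ∷ [] ⊆ b ∷ [] → encode (a ∷ []) ≼ encode (b ∷ [])
  to A⊆B = p⊆q⇒∁p⊇∁q A⊆B , λ ()
  from : encode (a ∷ []) ≼ encode (b ∷ []) → a ∷ [] ⊆ b ∷ []
  from (∁B⊆∁A , _) = ∁p⊆∁q⇒p⊇q ∁B⊆∁A
encode-⊆⇔≼ (a₀ ∷ a₁ ∷ A) (b₀ ∷ b₁ ∷ B) = mk⇔ to from
  where
  to : a₀ ∷ a₁ ∷ A ⊆ b₀ ∷ b₁ ∷ B → encode (a₀ ∷ a₁ ∷ A) ≼ encode (b₀ ∷ b₁ ∷ B)
  to A⊆B = ∷⊆∷⁺ (not-antitone-≤ (∧-mono-≤ a₀≤b₀ a₁≤b₁))
             (∷⊆∷⁺ (not-antitone-≤ (∨-mono-≤ a₀≤b₀ a₁≤b₁)) (p⊆q⇒∁p⊇∁q (drop-∷-⊆ (drop-∷-⊆ A⊆B))))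
         , encode-signs-agree a₀≤b₀ a₁≤b₁
    where
    a₀≤b₀ : a₀ ≤ᵇ b₀
    a₀≤b₀ = ∷⊆∷⁻ A⊆B
    a₁≤b₁ : a₁ ≤ᵇ b₁
    a₁≤b₁ = ∷⊆∷⁻ (drop-∷-⊆ A⊆B)
  from : encode (a₀ ∷ a₁ ∷ A) ≼ encode (b₀ ∷ b₁ ∷ B) → a₀ ∷ a₁ ∷ A ⊆ b₀ ∷ b₁ ∷ B
  from (cuts⊇ , agree) with encode-heads-≤ a₀ a₁ b₀ b₁ (∷⊆∷⁻ cuts⊇) (∷⊆∷⁻ (drop-∷-⊆ cuts⊇)) agree
  ... | a₀≤b₀ , a₁≤b₁ = ∷⊆∷⁺ a₀≤b₀ (∷⊆∷⁺ a₁≤b₁ (∁p⊆∁q⇒p⊇q (drop-∷-⊆ (drop-∷-⊆ cuts⊇))))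

allowed-inside : ∀ {n} {S : Subset n} → AllowedCuts (inside ∷ S)
allowed-inside p (_ , minimal) p≡1 = contradiction (subst (_≤ 0) p≡1 (minimal zero vhere)) λ ()

allowed-outside₂ : ∀ {n} {S : Subset n} → AllowedCuts (outside ∷ outside ∷ S)
allowed-outside₂ zero          _             ()
allowed-outside₂ (suc zero)    (vthere () , _) _
allowed-outside₂ (suc (suc p)) _             ()

allowed-singleton : ∀ {a} → AllowedCuts (a ∷ [])
allowed-singleton zero _ ()

encode-allowed : ∀ {n} (A : Subset n) → AllowedCuts (proj₂ (encode A))
encode-allowed []                 ()
encode-allowed (a ∷ [])           = allowed-singleton
encode-allowed (false ∷ a₁ ∷ A)   = allowed-inside
encode-allowed (true ∷ false ∷ A) = allowed-inside
encode-allowed (true ∷ true ∷ A)  = allowed-outside₂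

encode-∁-tail : ∀ {n} a₀ a₁ (S : Subset n) →
  proj₂ (encode (a₀ ∷ a₁ ∷ ∁ S)) ≡ not (a₀ ∧ a₁) ∷ not (a₀ ∨ a₁) ∷ S
encode-∁-tail a₀ a₁ S = cong (λ S′ → not (a₀ ∧ a₁) ∷ not (a₀ ∨ a₁) ∷ S′) (∁-involutive S)

encode-onto : ∀ {n} s (S : Subset n) → AllowedCuts S →
  ∃ λ A → proj₂ (encode A) ≡ S × (SignSensitive S → proj₁ (encode A) ≡ s)
encode-onto s     []                   _ = [] , refl , λ ()
encode-onto s     (c ∷ [])             _ = ∁ (c ∷ []) , cong (_∷ []) (not-involutive c) , λ ()
encode-onto s     (true ∷ true ∷ S)   _ = false ∷ false ∷ ∁ S , encode-∁-tail false false S , λ ()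
encode-onto s     (false ∷ false ∷ S) _ = true ∷ true ∷ ∁ S   , encode-∁-tail true true S   , λ ()
encode-onto false (true ∷ false ∷ S)  _ = true ∷ false ∷ ∁ S  , encode-∁-tail true false S  , λ _ → refl
encode-onto true  (true ∷ false ∷ S)  _ = false ∷ true ∷ ∁ S  , encode-∁-tail false true S  , λ _ → refl
encode-onto s     (false ∷ true ∷ S)  allowed =
  contradiction refl (allowed (suc zero) (vthere vhere , minimal))
  where
  minimal : ∀ q → q ∈ₛ false ∷ true ∷ S → 1 ≤ toℕ q
  minimal (suc q) _ = s≤s z≤n

word : ∀ {n} → Permutation′ n → BarVec n → Vec SLetter n
word ω ε = Vec.tabulate λ j → suc (toℕ (ω ⟨$⟩ʳ j)) , ε j

-- taggedWord tags with a function local to its where block; this names it for taggedWord-tag.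
taggedWord-tabulates : ∀ {n} (ω : Permutation′ n) ε S →
  Σ (Fin n → SLetter × Bool) λ F → taggedWord ω ε S ≡ map F (allFin n)
taggedWord-tabulates ω ε S = _ , refl

taggedWord-tag : ∀ {n} (ω : Permutation′ n) ε S j →
  proj₂ (proj₁ (taggedWord-tabulates ω ε S) j) ≡ Vec.lookup S j
taggedWord-tag ω ε S j with j ∈? S
... | yes j∈S = sym (Vec.[]=⇒lookup j∈S)
... | no  j∉S = sym (¬-not (j∉S ∘ Vec.lookup⇒[]= j S))

tabulate≡tagged : ∀ {A : Set} {n} (g : Fin n → A) (S : Subset n) →
                  List.tabulate (λ j → g j , Vec.lookup S j) ≡ tagged (Vec.tabulate g) S
tabulate≡tagged g []      = refl
tabulate≡tagged g (s ∷ S) = cong ((g zero , s) ∷_) (tabulate≡tagged (g ∘ suc) S)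

taggedWord≡tagged : ∀ {n} (ω : Permutation′ n) ε S → taggedWord ω ε S ≡ tagged (word ω ε) S
taggedWord≡tagged {n} ω ε S = begin
  map F (allFin n)                                    ≡⟨ List.map-tabulate id F ⟩
  List.tabulate F                                     ≡⟨ List.tabulate-cong (cong (_ ,_) ∘ tag-j) ⟩
  List.tabulate (λ j → proj₁ (F j) , Vec.lookup S j)  ≡⟨ tabulate≡tagged (proj₁ ∘ F) S ⟩
  tagged (word ω ε) S                                 ∎
  where
  open ≡-Reasoning
  F : Fin n → SLetter × Bool
  F = proj₁ (taggedWord-tabulates ω ε S)
  tag-j : ∀ j → proj₂ (F j) ≡ Vec.lookup S j
  tag-j = taggedWord-tag ω ε S

segments≡cutAll : ∀ L → segments L ≡ cutAll L
segments≡cutAll []                = refl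
segments≡cutAll ((x , true) ∷ L)  = cong (cutBefore x true) (segments≡cutAll L)
segments≡cutAll ((x , false) ∷ L) = cong (cutBefore x false) (segments≡cutAll L)

split≡splitWord : ∀ {n} (ω : Permutation′ n) ε S → split ω ε S ≡ splitWord (word ω ε) S
split≡splitWord ω ε S =
  cong fromSegments (trans (segments≡cutAll (taggedWord ω ε S))
                           (cong cutAll (taggedWord≡tagged ω ε S)))

-- word ω (flipFirst ε) computes to signed true (word ω ε) only once n is zero or a successor.
splitAt≡splitSigned : ∀ {n} (ω : Permutation′ n) ε (i : Index n) →
  splitAt ω ε i ≡ splitSigned (word ω ε) (proj₁ i , proj₁ (proj₂ i))
splitAt≡splitSigned {zero}  ω ε (false , S , _) = split≡splitWord ω ε S
splitAt≡splitSigned {zero}  ω ε (true  , S , _) = split≡splitWord ω (flipFirst ε) S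
splitAt≡splitSigned {suc n} ω ε (false , S , _) = split≡splitWord ω ε S
splitAt≡splitSigned {suc n} ω ε (true  , S , _) = split≡splitWord ω (flipFirst ε) S

toList-map-tabulate : ∀ {A B : Set} {n} (f : A → B) (g : Fin n → A) →
  toList (Vec.map f (Vec.tabulate g)) ≡ List.tabulate (f ∘ g)
toList-map-tabulate {n = zero}  f g = refl
toList-map-tabulate {n = suc n} f g = cong (f (g zero) ∷_) (toList-map-tabulate f (g ∘ suc))

word-keys-unique : ∀ {n} (ω : Permutation′ n) ε → Unique (0 ∷ keys (word ω ε))
word-keys-unique ω ε = subst (Unique ∘ (0 ∷_)) (sym (toList-map-tabulate proj₁ _))
  (All-tabulate⁺ (λ _ ()) ∷ Unique-tabulate⁺ letters-injective)
  where
  letters-injective : ∀ {i j} → suc (toℕ (ω ⟨$⟩ʳ i)) ≡ suc (toℕ (ω ⟨$⟩ʳ j)) → i ≡ j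
  letters-injective {i} {j} eq = begin
    i                  ≡⟨ inverseˡ ω ⟨
    ω ⟨$⟩ˡ (ω ⟨$⟩ʳ i)  ≡⟨ cong (ω ⟨$⟩ˡ_) (toℕ-injective (suc-injective eq)) ⟩
    ω ⟨$⟩ˡ (ω ⟨$⟩ʳ j)  ≡⟨ inverseˡ ω ⟩
    j                  ∎
    where open ≡-Reasoning

≈SP-reflexive : ∀ {π τ} → π ≡ τ → π ≈SP τ
≈SP-reflexive refl = (λ b b∈ → b , b∈ , id , id) , (λ b b∈ → b , b∈ , id , id)

proposition8p1 : (n : ℕ) (ω : Permutation′ n) (ε : BarVec n) →
    InD n ω ε → IsoToBoolean n ω ε
proposition8p1 n ω ε _ = index , order-embedding , onto
  where
  index : Subset n → Index n
  index A = proj₁ (encode A) , proj₂ (encode A) , encode-allowed A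

  order-embedding : ∀ A B → (A ⊆ B) ⇔ (splitAt ω ε (index A) ≤B splitAt ω ε (index B))
  order-embedding A B =
    subst₂ (λ π τ → (A ⊆ B) ⇔ (π ≤B τ))
      (sym (splitAt≡splitSigned ω ε (index A))) (sym (splitAt≡splitSigned ω ε (index B)))
      (⇔.trans (encode-⊆⇔≼ A B)
               (⇔.sym (splitSigned-≤B⇔≼ (word-keys-unique ω ε) (encode A) (encode B))))

  onto : ∀ i → ∃ λ A → splitAt ω ε (index A) ≈SP splitAt ω ε i
  onto i@(s , S , allowed) with encode-onto s S allowed
  ... | A , refl , agree = A , ≈SP-reflexive (begin
    splitAt ω ε (index A)                 ≡⟨ splitAt≡splitSigned ω ε (index A) ⟩
    splitSigned (word ω ε) (encode A)     ≡⟨ splitSigned-sign-cong {W = word ω ε} agree ⟩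
    splitSigned (word ω ε) (s , S)        ≡⟨ splitAt≡splitSigned ω ε i ⟨
    splitAt ω ε i                         ∎)
    where open ≡-Reasoning
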